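{- Let $s,t$ be positive integers, let $k=\gcd(s,t)$, and write $s = s'k$, $t=t'k$. Let $F$ be a gerechte framework of order $n$ in which every region is either an $s\times t$ rectangle or a $t \times s$ rectangle. Then for each $1 \le i \le n$, the number of $s\times t$ regions of $F$ that begin in row $i$ is a multiple of $s'$.
   Context: A gerechte framework of order $n$ is a partition of the cells of an $n\times n$ array (rows and columns numbered $1,\dots,n$ from the top and from the left) into $n$ regions, each containing $n$ cells (so here $n=st$). A region is an $a\times b$ rectangle if it consists of the cells lying in some $a$ consecutive rows and some $b$ consecutive columns (height $a$, width $b$). A rectangular region begins in row $i$ if its uppermost cells lie in row $i$. -}

module Defs where

open import Data.Nat using (ℕ; _+_; _≤_; _<_; _≤?_; _<?_)
open import Data.Fin using (Fin; toℕ; _≟_)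
open import Data.Fin.Properties using (all?; any?)
open import Data.List using (List; length; filter; cartesianProduct)
open import Data.List.Base using (allFin)
open import Data.Product using (_×_; _,_; proj₁; proj₂; Σ; ∃)
open import Data.Sum using (_⊎_)
open import Relation.Binary.PropositionalEquality using (_≡_)
open import Relation.Nullary using (Dec)
open import Relation.Nullary.Decidable using (_×-dec_; _→-dec_)

-- Rows and columns are indexed 0,…,n-1 (row index i : Fin n is row i+1 of the paper).
-- A cell is a pair (row , column).
Cell : ℕ → Set
Cell n = Fin n × Fin n

allCells : (n : ℕ) → List (Cell n)
allCells n = cartesianProduct (allFin n) (allFin n)

-- A partition of the cells of the n×n array into regions labelled by Fin n:
-- each cell is assigned the label of the region containing it.
Labelling : ℕ → Set
Labelling n = Fin n → Fin n → Fin n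

regionSize : {n : ℕ} → Labelling n → Fin n → ℕ
regionSize {n} F r = length (filter (λ c → F (proj₁ c) (proj₂ c) ≟ r) (allCells n))

record GerechteFramework (n : ℕ) : Set where
  field
    region     : Labelling n
    regionCard : ∀ r → regionSize region r ≡ n
open GerechteFramework public

InRect : {n : ℕ} → Fin n → Fin n → ℕ → ℕ → Fin n → Fin n → Set
InRect i j a b x y =
  (toℕ i ≤ toℕ x) × (toℕ x < toℕ i + a) × (toℕ j ≤ toℕ y) × (toℕ y < toℕ j + b)

-- In particular its
-- uppermost cells lie in row i, i.e. it begins in row i.
IsRectAt : {n : ℕ} → GerechteFramework n → Fin n → (a b : ℕ) → Fin n → Fin n → Set
IsRectAt {n} F r a b i j =
  (toℕ i + a ≤ n) × (toℕ j + b ≤ n) ×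
  (∀ x y → (region F x y ≡ r → InRect i j a b x y) × (InRect i j a b x y → region F x y ≡ r))

IsRect : {n : ℕ} → GerechteFramework n → Fin n → (a b : ℕ) → Set
IsRect F r a b = ∃ λ i → ∃ λ j → IsRectAt F r a b i j

IsRectBeginningIn : {n : ℕ} → GerechteFramework n → Fin n → (a b : ℕ) → Fin n → Set
IsRectBeginningIn F r a b i = ∃ λ j → IsRectAt F r a b i j

inRect? : {n : ℕ} (i j : Fin n) (a b : ℕ) (x y : Fin n) → Dec (InRect i j a b x y)
inRect? i j a b x y =
  (toℕ i ≤? toℕ x) ×-dec (toℕ x <? toℕ i + a) ×-dec (toℕ j ≤? toℕ y) ×-dec (toℕ y <? toℕ j + b)

isRectBeginningIn? : {n : ℕ} (F : GerechteFramework n) (r : Fin n) (a b : ℕ) (i : Fin n) →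
  Dec (IsRectBeginningIn F r a b i)
isRectBeginningIn? {n} F r a b i = any? λ j →
  (toℕ i + a ≤? n) ×-dec (toℕ j + b ≤? n) ×-dec
  all? (λ x → all? (λ y →
    ((region F x y ≟ r) →-dec inRect? i j a b x y) ×-dec
    (inRect? i j a b x y →-dec (region F x y ≟ r))))

countRectsBeginningIn : {n : ℕ} → GerechteFramework n → (a b : ℕ) → Fin n → ℕ
countRectsBeginningIn {n} F a b i =
  length (filter (λ r → isRectBeginningIn? F r a b i) (allFin n))

-- Fix a row x (rows numbered from 0) and count its st cells region by region: an
-- s×t region meets row x in t cells exactly when it begins in one of the rows
-- x+1-s, …, x, and a t×s region meets it in 0 or s cells.  So t·Wₓ + s·D = st,
-- where Wₓ is the number of s×t regions beginning in that window of rows; hence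
-- s ∣ t·Wₓ and, as s′ = s/k is coprime to t/k, s′ ∣ Wₓ.  Writing P(m) for the
-- number of s×t regions beginning above row m, P(x+1) = P(x+1-s) + Wₓ, so s′ ∣ P(m)
-- for every m by strong induction, and the count for row i is P(i+1) - P(i).
module Submission where

open import Defs
open import Data.Bool.Base using (Bool; true; false; _∧_)
open import Data.Bool.Properties using (∧-assoc)
open import Data.Empty using (⊥-elim)
open import Data.Fin using (Fin; zero; suc; toℕ; fromℕ<; _≟_)
open import Data.Fin.Properties using (any?; toℕ-injective; toℕ<n; toℕ-fromℕ<)
open import Data.List.Base using (length; filter; tabulate)
open import Data.Nat using (ℕ; zero; suc; _+_; _*_; _∸_; _≤_; _<_; _≤?_; _<?_; z≤n; s≤s; s≤s⁻¹; NonZero; ≢-nonZero)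
open import Data.Nat.Coprimality using (Coprime; coprime-/gcd; coprime-divisor)
open import Data.Nat.Divisibility using (_∣_; divides; _∣0; n∣m*n; ∣m∣n⇒∣m+n; ∣m+n∣m⇒∣n; *-cancelʳ-∣)
open import Data.Nat.DivMod using (_/_; m*n/n≡m; m/n*n≡m)
open import Data.Nat.GCD using (gcd; gcd[m,n]≢0; gcd[m,n]∣n)
open import Data.Nat.Induction using (<-rec)
open import Data.Nat.Properties
  using (*-identityˡ; *-comm; *-assoc; +-comm; +-identityʳ; +-cancelˡ-≡; m≤m+n; m<m+n; n≤1+n;
         ≤-refl; ≤-reflexive; ≤-trans; ≤-antisym; <⇒≤; <-≤-trans; <⇒≱; ≮⇒≥; m∸n≤m; m≤n+m∸n; m<n⇒n≢0; ∸-monoˡ-≤;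
         ∸-monoʳ-≤; +-monoʳ-≤; m+n∸n≡m; +-*-semiring)
open import Algebra.Properties.Semiring.Sum +-*-semiring
  using (sum-syntax; sum-cong-≗; sum-replicate-zero; ∑-distrib-+; ∑-comm; *-distribˡ-sum; *-distribʳ-sum)
open import Data.Product using (_×_; _,_; proj₁; proj₂; ∃)
open import Data.Sum using (_⊎_; inj₁; inj₂)
open import Level using (Level)
open import Function.Bundles using (_⇔_; mk⇔)
open import Relation.Binary.PropositionalEquality
  using (_≡_; refl; sym; trans; cong; cong₂; subst; subst₂; module ≡-Reasoning)
open import Relation.Nullary using (Dec; yes; no; does; ¬_)
open import Relation.Nullary.Decidable using (_×-dec_; dec-false; does-⇔)
open import Relation.Unary using (Pred; Decidable)

private
  variable
    p q : Level
    P : Set p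
    Q : Set q

χ : Bool → ℕ
χ true  = 1
χ false = 0

[_] : Dec P → ℕ
[ P? ] = χ (does P?)

χ-∧ : ∀ a b → χ (a ∧ b) ≡ χ a * χ b
χ-∧ true  b = sym (*-identityˡ (χ b))
χ-∧ false b = refl

[]-⇔ : P ⇔ Q → (P? : Dec P) (Q? : Dec Q) → [ P? ] ≡ [ Q? ]
[]-⇔ P⇔Q P? Q? = cong χ (does-⇔ P⇔Q P? Q?)

[]-no : (P? : Dec P) → ¬ P → [ P? ] ≡ 0
[]-no P? ¬p = cong χ (dec-false P? ¬p)

length-filter-tabulate : ∀ {a} {A : Set a} {R : Pred A p} (R? : Decidable R) {n} (f : Fin n → A) →
  length (filter R? (tabulate f)) ≡ ∑[ i < n ] [ R? (f i) ]
length-filter-tabulate R? {zero}  f = refl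
length-filter-tabulate R? {suc n} f with does (R? (f zero))
... | true  = cong suc (length-filter-tabulate R? (λ i → f (suc i)))
... | false = length-filter-tabulate R? (λ i → f (suc i))

sum-ones : ∀ n → ∑[ i < n ] 1 ≡ n
sum-ones zero    = refl
sum-ones (suc n) = cong suc (sum-ones n)

sum-δ : ∀ {n} (v : Fin n) → ∑[ r < n ] [ v ≟ r ] ≡ 1
sum-δ {suc n} zero    = cong suc (sum-replicate-zero n)
sum-δ         (suc v) = sum-δ v

within? : ∀ lo hi v → Dec (lo ≤ v × v < hi)
within? lo hi v = (lo ≤? v) ×-dec (v <? hi)

within : ℕ → ℕ → ℕ → ℕ
within lo hi v = [ within? lo hi v ]

within-empty : ∀ lo v → within lo lo v ≡ 0
within-empty lo v = []-no (within? lo lo v) λ (lo≤v , v<lo) → <⇒≱ v<lo lo≤v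

within-split : ∀ {lo mid hi} v → lo ≤ mid → mid ≤ hi →
  within lo hi v ≡ within lo mid v + within mid hi v
within-split {lo} {mid} {hi} v lo≤mid mid≤hi with v <? mid
... | yes v<mid = trans (sym (+-identityʳ _)) (cong₂ _+_
  ([]-⇔ (mk⇔ (λ (lo≤v , _) → lo≤v , v<mid) (λ (lo≤v , _) → lo≤v , <-≤-trans v<mid mid≤hi))
    (within? lo hi v) (within? lo mid v))
  (sym ([]-no (within? mid hi v) λ (mid≤v , _) → <⇒≱ v<mid mid≤v)))
... | no v≮mid = cong₂ _+_
  (sym ([]-no (within? lo mid v) λ (_ , v<mid) → v≮mid v<mid))
  ([]-⇔ (mk⇔ (λ (_ , v<hi) → ≮⇒≥ v≮mid , v<hi) (λ (_ , v<hi) → ≤-trans lo≤mid (≮⇒≥ v≮mid) , v<hi))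
    (within? lo hi v) (within? mid hi v))

within-shift : ∀ i a x → within i (i + a) x ≡ within (suc x ∸ a) (suc x) i
within-shift i a x = []-⇔ (mk⇔ to from) (within? i (i + a) x) (within? (suc x ∸ a) (suc x) i)
  where
  to : i ≤ x × x < i + a → suc x ∸ a ≤ i × i < suc x
  to (i≤x , x<i+a) = ≤-trans (∸-monoˡ-≤ a x<i+a) (≤-reflexive (m+n∸n≡m i a)) , s≤s i≤x
  from : suc x ∸ a ≤ i × i < suc x → i ≤ x × x < i + a
  from (x+1-a≤i , i<x+1) =
    s≤s⁻¹ i<x+1 ,
    ≤-trans (m≤n+m∸n (suc x) a) (subst (a + (suc x ∸ a) ≤_) (+-comm a i) (+-monoʳ-≤ a x+1-a≤i))

sum-below : ∀ {n h} → h ≤ n → ∑[ y < n ] within 0 h (toℕ y) ≡ h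
sum-below {zero}  z≤n = refl
sum-below {suc n} {zero}  _         = sum-replicate-zero (suc n)
sum-below {suc n} {suc h} (s≤s h≤n) = cong suc (sum-below h≤n)

sum-within : ∀ {n} lo b → lo + b ≤ n → ∑[ y < n ] within lo (lo + b) (toℕ y) ≡ b
sum-within {n} lo b lo+b≤n = +-cancelˡ-≡ lo _ _ (begin
  lo + ∑[ y < n ] within lo (lo + b) (toℕ y)
    ≡⟨ cong (_+ ∑[ y < n ] within lo (lo + b) (toℕ y)) (sym (sum-below {n} (≤-trans (m≤m+n lo b) lo+b≤n))) ⟩
  ∑[ y < n ] within 0 lo (toℕ y) + ∑[ y < n ] within lo (lo + b) (toℕ y)
    ≡⟨ sym (∑-distrib-+ {n} (λ y → within 0 lo (toℕ y)) (λ y → within lo (lo + b) (toℕ y))) ⟩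
  ∑[ y < n ] (within 0 lo (toℕ y) + within lo (lo + b) (toℕ y))
    ≡⟨ sum-cong-≗ {n} (λ y → sym (within-split (toℕ y) z≤n (m≤m+n lo b))) ⟩
  ∑[ y < n ] within 0 (lo + b) (toℕ y)
    ≡⟨ sum-below {n} lo+b≤n ⟩
  lo + b ∎)
  where open ≡-Reasoning

∣*⇒cofactor∣ : ∀ {s t a s′} → 0 < s → s ≡ s′ * gcd s t → s ∣ a * t → s′ ∣ a
∣*⇒cofactor∣ {s} {t} {a} {s′} s>0 s≡s′k s∣at = coprime-divisor s′⊥t′ (*-cancelʳ-∣ k s′k∣t′ak)
  where
  k = gcd s t
  instance
    k≢0 : NonZero k
    k≢0 = ≢-nonZero (gcd[m,n]≢0 s t (inj₁ (m<n⇒n≢0 s>0)))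
  t′ = t / k
  s′⊥t′ : Coprime s′ t′
  s′⊥t′ = subst (λ m → Coprime m t′) (trans (cong (_/ k) s≡s′k) (m*n/n≡m s′ k)) (coprime-/gcd s t)
  at≡t′ak : a * t ≡ t′ * a * k
  at≡t′ak = begin
    a * t        ≡⟨ cong (a *_) (sym (m/n*n≡m (gcd[m,n]∣n s t))) ⟩
    a * (t′ * k) ≡⟨ sym (*-assoc a t′ k) ⟩
    a * t′ * k   ≡⟨ cong (_* k) (*-comm a t′) ⟩
    t′ * a * k   ∎
    where open ≡-Reasoning
  s′k∣t′ak : s′ * k ∣ t′ * a * k
  s′k∣t′ak = subst₂ _∣_ s≡s′k at≡t′ak s∣at

module _ {n} (F : GerechteFramework n) where

  cellsInRow : Fin n → Fin n → ℕ
  cellsInRow r x = ∑[ y < n ] [ region F x y ≟ r ]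

  sum-cellsInRow : ∀ x → ∑[ r < n ] cellsInRow r x ≡ n
  sum-cellsInRow x = begin
    ∑[ r < n ] ∑[ y < n ] [ region F x y ≟ r ]  ≡⟨ ∑-comm (λ r y → [ region F x y ≟ r ]) ⟩
    ∑[ y < n ] ∑[ r < n ] [ region F x y ≟ r ]  ≡⟨ sum-cong-≗ {n} (λ y → sum-δ (region F x y)) ⟩
    ∑[ y < n ] 1                                ≡⟨ sum-ones n ⟩
    n                                           ∎
    where open ≡-Reasoning

  inRect-indicator : ∀ (i j : Fin n) a b x y →
    [ inRect? i j a b x y ] ≡ within (toℕ i) (toℕ i + a) (toℕ x) * within (toℕ j) (toℕ j + b) (toℕ y)
  inRect-indicator i j a b x y =
    trans (cong χ (sym (∧-assoc inRow inRow′ inColumn))) (χ-∧ (inRow ∧ inRow′) inColumn)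
    where
    inRow    = does (toℕ i ≤? toℕ x)
    inRow′   = does (toℕ x <? toℕ i + a)
    inColumn = does (within? (toℕ j) (toℕ j + b) (toℕ y))

  cellsInRow-rect : ∀ {r a b i j} x → IsRectAt F r a b i j →
    cellsInRow r x ≡ within (toℕ i) (toℕ i + a) (toℕ x) * b
  cellsInRow-rect {r} {a} {b} {i} {j} x (_ , j+b≤n , inside) = begin
    ∑[ y < n ] [ region F x y ≟ r ]
      ≡⟨ sum-cong-≗ {n} (λ y → []-⇔ (mk⇔ (proj₁ (inside x y)) (proj₂ (inside x y)))
                                    (region F x y ≟ r) (inRect? i j a b x y)) ⟩
    ∑[ y < n ] [ inRect? i j a b x y ]
      ≡⟨ sum-cong-≗ {n} (inRect-indicator i j a b x) ⟩
    ∑[ y < n ] (rowIn * within (toℕ j) (toℕ j + b) (toℕ y))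
      ≡⟨ sym (*-distribˡ-sum {n} rowIn (λ y → within (toℕ j) (toℕ j + b) (toℕ y))) ⟩
    rowIn * ∑[ y < n ] within (toℕ j) (toℕ j + b) (toℕ y)
      ≡⟨ cong (rowIn *_) (sum-within {n} (toℕ j) b j+b≤n) ⟩
    rowIn * b
      ∎
    where
    open ≡-Reasoning
    rowIn = within (toℕ i) (toℕ i + a) (toℕ x)

  topRow-unique : ∀ {r a b i j i′ j′} → 0 < a → 0 < b →
    IsRectAt F r a b i j → IsRectAt F r a b i′ j′ → i ≡ i′
  topRow-unique {r} {a} {b} a>0 b>0 R R′ = toℕ-injective (≤-antisym (top≤ R R′) (top≤ R′ R))
    where
    top≤ : ∀ {i j i′ j′} → IsRectAt F r a b i j → IsRectAt F r a b i′ j′ → toℕ i ≤ toℕ i′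
    top≤ {i′ = i′} {j′} (_ , _ , inside) (_ , _ , inside′) =
      proj₁ (proj₁ (inside i′ j′) (proj₂ (inside′ i′ j′) (≤-refl , m<m+n _ a>0 , ≤-refl , m<m+n _ b>0)))

  module _ {s t} (s>0 : 0 < s) (t>0 : 0 < t) (tiled : ∀ r → IsRect F r s t ⊎ IsRect F r t s) where

    isRect? : ∀ r → Dec (IsRect F r s t)
    isRect? r = any? (isRectBeginningIn? F r s t)

    beginsWithin : ℕ → ℕ → ∀ {r} → Dec (IsRect F r s t) → ℕ
    beginsWithin lo hi (yes (i , _)) = within lo hi (toℕ i)
    beginsWithin lo hi (no _)        = 0

    rectsBeginningWithin : ℕ → ℕ → ℕ
    rectsBeginningWithin lo hi = ∑[ r < n ] beginsWithin lo hi (isRect? r)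

    rectsBeginningWithin-empty : ∀ lo → rectsBeginningWithin lo lo ≡ 0
    rectsBeginningWithin-empty lo = trans (sum-cong-≗ {n} (λ r → empty (isRect? r))) (sum-replicate-zero n)
      where
      empty : ∀ {r} (R? : Dec (IsRect F r s t)) → beginsWithin lo lo R? ≡ 0
      empty (yes (i , _)) = within-empty lo (toℕ i)
      empty (no _)        = refl

    rectsBeginningWithin-split : ∀ {lo mid hi} → lo ≤ mid → mid ≤ hi →
      rectsBeginningWithin lo hi ≡ rectsBeginningWithin lo mid + rectsBeginningWithin mid hi
    rectsBeginningWithin-split {lo} {mid} {hi} lo≤mid mid≤hi =
      trans (sum-cong-≗ {n} (λ r → split (isRect? r)))
            (∑-distrib-+ (λ r → beginsWithin lo mid (isRect? r)) (λ r → beginsWithin mid hi (isRect? r)))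
      where
      split : ∀ {r} (R? : Dec (IsRect F r s t)) →
        beginsWithin lo hi R? ≡ beginsWithin lo mid R? + beginsWithin mid hi R?
      split (yes (i , _)) = within-split (toℕ i) lo≤mid mid≤hi
      split (no _)        = refl

    countRectsBeginningIn≡ : ∀ x →
      countRectsBeginningIn F s t x ≡ rectsBeginningWithin (toℕ x) (suc (toℕ x))
    countRectsBeginningIn≡ x =
      trans (length-filter-tabulate (λ r → isRectBeginningIn? F r s t x) (λ r → r))
            (sum-cong-≗ {n} (λ r → beginsIn (isRect? r)))
      where
      beginsIn : ∀ {r} (R? : Dec (IsRect F r s t)) →
        [ isRectBeginningIn? F r s t x ] ≡ beginsWithin (toℕ x) (suc (toℕ x)) R?
      beginsIn {r} (yes (i , j , R)) =
        []-⇔ (mk⇔ to from) (isRectBeginningIn? F r s t x) (within? (toℕ x) (suc (toℕ x)) (toℕ i))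
        where
        to : IsRectBeginningIn F r s t x → toℕ x ≤ toℕ i × toℕ i < suc (toℕ x)
        to (j′ , R′) rewrite topRow-unique s>0 t>0 R R′ = ≤-refl , ≤-refl
        from : toℕ x ≤ toℕ i × toℕ i < suc (toℕ x) → IsRectBeginningIn F r s t x
        from (x≤i , i<x+1) rewrite toℕ-injective (≤-antisym x≤i (s≤s⁻¹ i<x+1)) = j , R
      beginsIn {r} (no ¬R) = []-no (isRectBeginningIn? F r s t x) (λ (j , R) → ¬R (x , j , R))

    window : Fin n → ℕ
    window x = rectsBeginningWithin (suc (toℕ x) ∸ s) (suc (toℕ x))

    cellsInRow-decomposition : ∀ r x →
      ∃ λ d → cellsInRow r x ≡ beginsWithin (suc (toℕ x) ∸ s) (suc (toℕ x)) (isRect? r) * t + d * s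
    cellsInRow-decomposition r x with isRect? r | tiled r
    ... | yes (i , j , R) | _ =
      0 , trans (cellsInRow-rect x R)
                (trans (cong (_* t) (within-shift (toℕ i) s (toℕ x))) (sym (+-identityʳ _)))
    ... | no ¬R | inj₁ R = ⊥-elim (¬R R)
    ... | no _  | inj₂ (i , j , R) = within (toℕ i) (toℕ i + t) (toℕ x) , cellsInRow-rect x R

    row-equation : ∀ x → ∃ λ D → window x * t + D * s ≡ n
    row-equation x = ∑[ r < n ] d r , (begin
      window x * t + (∑[ r < n ] d r) * s
        ≡⟨ cong₂ _+_ (*-distribʳ-sum t w) (*-distribʳ-sum s d) ⟩
      ∑[ r < n ] (w r * t) + ∑[ r < n ] (d r * s)
        ≡⟨ sym (∑-distrib-+ (λ r → w r * t) (λ r → d r * s)) ⟩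
      ∑[ r < n ] (w r * t + d r * s)
        ≡⟨ sum-cong-≗ {n} (λ r → sym (proj₂ (cellsInRow-decomposition r x))) ⟩
      ∑[ r < n ] cellsInRow r x
        ≡⟨ sum-cellsInRow x ⟩
      n ∎)
      where
      open ≡-Reasoning
      w d : Fin n → ℕ
      w r = beginsWithin (suc (toℕ x) ∸ s) (suc (toℕ x)) (isRect? r)
      d r = proj₁ (cellsInRow-decomposition r x)

    module _ {s′} (s≡s′k : s ≡ s′ * gcd s t) (n≡st : n ≡ s * t) where

      s′∣window : ∀ x → s′ ∣ window x
      s′∣window x = ∣*⇒cofactor∣ s>0 s≡s′k s∣window*t
        where
        D = proj₁ (row-equation x)
        s∣n : s ∣ n
        s∣n = divides t (trans n≡st (*-comm s t))
        s∣window*t : s ∣ window x * t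
        s∣window*t = ∣m+n∣m⇒∣n
          (subst (s ∣_) (trans (sym (proj₂ (row-equation x))) (+-comm (window x * t) (D * s))) s∣n)
          (n∣m*n D)

      s′∣prefix : ∀ m → m ≤ n → s′ ∣ rectsBeginningWithin 0 m
      s′∣prefix = <-rec (λ m → m ≤ n → s′ ∣ rectsBeginningWithin 0 m) step
        where
        step : ∀ m → (∀ {k} → k < m → k ≤ n → s′ ∣ rectsBeginningWithin 0 k) →
               m ≤ n → s′ ∣ rectsBeginningWithin 0 m
        step zero    _  _   = subst (s′ ∣_) (sym (rectsBeginningWithin-empty 0)) (s′ ∣0)
        step (suc x) ih x<n =
          subst (s′ ∣_) (sym (rectsBeginningWithin-split z≤n (m∸n≤m (suc x) s)))
                (∣m∣n⇒∣m+n (ih (s≤s (∸-monoʳ-≤ (suc x) s>0)) (≤-trans (m∸n≤m (suc x) s) x<n))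
                           (subst (λ v → s′ ∣ rectsBeginningWithin (suc v ∸ s) (suc v))
                                  (toℕ-fromℕ< x<n) (s′∣window (fromℕ< x<n))))

      s′∣countRectsBeginningIn : ∀ x → s′ ∣ countRectsBeginningIn F s t x
      s′∣countRectsBeginningIn x = subst (s′ ∣_) (sym (countRectsBeginningIn≡ x))
        (∣m+n∣m⇒∣n (subst (s′ ∣_) (rectsBeginningWithin-split z≤n (n≤1+n (toℕ x)))
                                  (s′∣prefix (suc (toℕ x)) (toℕ<n x)))
                   (s′∣prefix (toℕ x) (<⇒≤ (toℕ<n x))))

lemma7 : (s t : ℕ) → 0 < s → 0 < t →
    (s′ : ℕ) → s ≡ s′ * gcd s t →
    (F : GerechteFramework (s * t)) →
    (∀ r → IsRect F r s t ⊎ IsRect F r t s) →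
    (i : Fin (s * t)) → s′ ∣ countRectsBeginningIn F s t i
lemma7 s t s>0 t>0 s′ s≡s′k F tiled = s′∣countRectsBeginningIn F s>0 t>0 tiled s≡s′k refl
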